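{- There is an absolute constant $c>0$ such that the following holds. Let $H=(V,E)$ and $H'=(V,E')$ be unweighted undirected graphs on the same node set with $H$ connected and $E\subseteq E'$, let $s\in V$, and let $\delta>0$. If there is a node $y\in V$ with $d_H(y,s)\geq d_{H'}(y,s)+\delta$, then $$\sum_{x\in V} d_H(x,s)\;\geq\;\sum_{x\in V} d_{H'}(x,s)+c\,\delta^2 .$$
   Formalization: The parameter δ ranges over the positive rationals, and the constant c is taken in the rationals. -}

module Defs where

open import Data.Nat using (ℕ; zero; suc; _≤_)
open import Data.Fin using (Fin)
open import Data.Bool using (Bool; true)
open import Data.Product using (∃; _×_)
open import Data.Vec using (tabulate)
import Data.Vec as Vec
open import Relation.Binary.PropositionalEquality using (_≡_)

-- An unweighted undirected graph on the node set V = Fin n,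
-- given by a symmetric adjacency relation (loops are irrelevant for distances).
record Graph (n : ℕ) : Set where
  field
    adj : Fin n → Fin n → Bool
    adj-sym : ∀ x y → adj x y ≡ adj y x
open Graph public

_⊆E_ : ∀ {n} → Graph n → Graph n → Set
H ⊆E H' = ∀ x y → adj H x y ≡ true → adj H' x y ≡ true

data Walk {n : ℕ} (G : Graph n) : Fin n → Fin n → ℕ → Set where
  here : ∀ {x} → Walk G x x zero
  step : ∀ {x y z k} → adj G x y ≡ true → Walk G y z k → Walk G x z (suc k)

Connected : ∀ {n} → Graph n → Set
Connected G = ∀ x y → ∃ λ k → Walk G x y k

IsDist : ∀ {n} → Graph n → Fin n → Fin n → ℕ → Set
IsDist G x y k = Walk G x y k × (∀ m → Walk G x y m → k ≤ m)

sumV : ∀ {n} → (Fin n → ℕ) → ℕ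
sumV f = Vec.sum (tabulate f)

-- Write A = d_H(y,s), B = d_H'(y,s), D = A ∸ B and g(x) = d_H(x,s) ∸ d_H'(x,s).
-- Walk j steps along a shortest H-path from y towards s, reaching a node u_j
-- with d_H(u_j) = A ∸ j (a geodesic point).  The same j steps, walked
-- backwards in the larger graph H', give d_H'(u_j) ≤ j + B, hence
-- g(u_j) ≥ D ∸ 2j.  The nodes u_0, …, u_{D-1} are distinct since their
-- H-distances differ, so Σₓ g(x) ≥ Σ_{j<D} (D ∸ 2j) ≥ D²/4.
module Submission where

open import Defs
open import Data.Nat using (ℕ)
open import Data.Fin using (Fin)

module Walks {n : ℕ} {G : Graph n} where
  open import Data.Nat using (suc; _+_; _∸_; _≤_; z≤n; s≤s)
  open import Data.Bool using (true)
  open import Data.Product using (∃; _×_; _,_)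
  open import Relation.Binary.PropositionalEquality using (_≡_; sym; trans)

  snoc : ∀ {x y z k} → Walk G x y k → adj G y z ≡ true → Walk G x z (suc k)
  snoc here e = step e here
  snoc (step e p) e' = step e (snoc p e')

  reverse : ∀ {x y k} → Walk G x y k → Walk G y x k
  reverse here = here
  reverse (step {x} {y} e p) = snoc (reverse p) (trans (sym (adj-sym G x y)) e)

  _++_ : ∀ {x y z a b} → Walk G x y a → Walk G y z b → Walk G x z (a + b)
  here ++ q = q
  step e p ++ q = step e (p ++ q)

  split : ∀ {x z k j} → Walk G x z k → j ≤ k →
          ∃ λ u → Walk G x u j × Walk G u z (k ∸ j)
  split {x} p z≤n = x , here , p
  split (step e p) (s≤s j≤k) with split p j≤k
  ... | u , front , back = u , step e front , back

module EdgeInclusion {n : ℕ} {H H' : Graph n} (sub : H ⊆E H') where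
  open import Data.Nat using (_≤_)
  open import Data.Product using (_,_)

  liftWalk : ∀ {x y k} → Walk H x y k → Walk H' x y k
  liftWalk here = here
  liftWalk (step {x} {y} e p) = step (sub x y e) (liftWalk p)

  distance-antitone : ∀ {x s a b} → IsDist H x s a → IsDist H' x s b → b ≤ a
  distance-antitone (walkH , _) (_ , minimalH') = minimalH' _ (liftWalk walkH)

module NodeSums where
  open import Data.Nat using (zero; suc; _+_; _≤_; z≤n)
  open import Data.Nat.Properties using (+-mono-≤; m≤m+n; m≤n+m; ≤-trans; +-commutativeSemigroup)
  open import Algebra.Properties.CommutativeSemigroup +-commutativeSemigroup using (interchange)
  import Data.Fin as F
  open import Data.Vec using (sum)
  open import Data.Vec.Properties using (tabulate-cong)
  open import Relation.Binary.PropositionalEquality using (_≡_; refl; trans; cong)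

  sumV-cong : ∀ {n} {f g : Fin n → ℕ} → (∀ x → f x ≡ g x) → sumV f ≡ sumV g
  sumV-cong h = cong sum (tabulate-cong h)

  sumV-+ : ∀ {n} (f g : Fin n → ℕ) → sumV (λ x → f x + g x) ≡ sumV f + sumV g
  sumV-+ {zero} f g = refl
  sumV-+ {suc n} f g =
    trans (cong ((f F.zero + g F.zero) +_) (sumV-+ (λ x → f (F.suc x)) (λ x → g (F.suc x))))
          (interchange (f F.zero) (g F.zero) _ _)

  sumV-mono : ∀ {n} {f g : Fin n → ℕ} → (∀ x → f x ≤ g x) → sumV f ≤ sumV g
  sumV-mono {zero} h = z≤n
  sumV-mono {suc n} h = +-mono-≤ (h F.zero) (sumV-mono (λ x → h (F.suc x)))

  term≤sumV : ∀ {n} (f : Fin n → ℕ) x → f x ≤ sumV f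
  term≤sumV f F.zero = m≤m+n _ _
  term≤sumV f (F.suc x) = ≤-trans (term≤sumV (λ y → f (F.suc y)) x) (m≤n+m _ _)

module Distances {n : ℕ} {G : Graph n} {s : Fin n} {d : Fin n → ℕ}
                 (isDist : ∀ x → IsDist G x s (d x)) where
  open import Data.Nat using (_+_; _∸_; _≤_)
  open import Data.Nat.Properties using (≤-antisym; m≤n+o⇒m∸n≤o)
  open import Data.Product using (∃; _×_; _,_; proj₁; proj₂)
  open import Relation.Binary.PropositionalEquality using (_≡_)
  open Walks

  triangle : ∀ {x u k} → Walk G x u k → d x ≤ k + d u
  triangle {x} {u} p = proj₂ (isDist x) _ (p ++ proj₁ (isDist u))

  geodesicPoint : ∀ y j → j ≤ d y → ∃ λ u → Walk G y u j × d u ≡ d y ∸ j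
  geodesicPoint y j j≤dy with split (proj₁ (isDist y)) j≤dy
  ... | u , front , back =
    u , front , ≤-antisym (proj₂ (isDist u) _ back)
                          (m≤n+o⇒m∸n≤o (d y) j (triangle front))

module RangeSums where
  open import Data.Nat using (zero; suc; _+_; _*_; _∸_; _≤_; z≤n; s≤s)
  open import Data.Nat.Properties
  open import Data.Nat.Solver using (module +-*-Solver)
  open +-*-Solver using (solve; _:+_; _:*_; _:=_; con)
  open import Relation.Binary.PropositionalEquality using (_≡_; refl; sym; trans; cong; cong₂)

  sumTo : ℕ → (ℕ → ℕ) → ℕ
  sumTo zero w = 0
  sumTo (suc L) w = w 0 + sumTo L (λ j → w (suc j))

  sumTo-snoc : ∀ L w → sumTo (suc L) w ≡ sumTo L w + w L
  sumTo-snoc zero w = +-identityʳ (w 0)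
  sumTo-snoc (suc L) w = trans (cong (w 0 +_) (sumTo-snoc L (λ j → w (suc j))))
                               (sym (+-assoc (w 0) _ _))

  sumTo-cong : ∀ L {v w} → (∀ j → v j ≡ w j) → sumTo L v ≡ sumTo L w
  sumTo-cong zero h = refl
  sumTo-cong (suc L) h = cong₂ _+_ (h 0) (sumTo-cong L (λ j → h (suc j)))

  tent : ℕ → ℕ
  tent D = sumTo D (λ j → D ∸ (j + j))

  tent-step : ∀ D → suc (suc D) + tent D ≤ tent (suc (suc D))
  tent-step D = +-monoʳ-≤ (suc (suc D)) (begin
      tent D
    ≤⟨ m≤m+n _ _ ⟩
      tent D + (D ∸ (D + D))
    ≡⟨ sym (sumTo-snoc D (λ j → D ∸ (j + j))) ⟩
      sumTo (suc D) (λ j → D ∸ (j + j))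
    ≡⟨ sumTo-cong (suc D) (λ j → cong (suc D ∸_) (sym (+-suc j j))) ⟩
      sumTo (suc D) (λ j → suc (suc D) ∸ (suc j + suc j)) ∎)
    where open ≤-Reasoning

  square≤4·tent : ∀ D → D * D ≤ 4 * tent D
  square≤4·tent zero = z≤n
  square≤4·tent (suc zero) = s≤s z≤n
  square≤4·tent (suc (suc D)) = begin
      suc (suc D) * suc (suc D)
    ≤⟨ m≤m+n _ 4 ⟩
      suc (suc D) * suc (suc D) + 4
    ≡⟨ solve 1 (λ d → (con 2 :+ d) :* (con 2 :+ d) :+ con 4
                      := d :* d :+ con 4 :* (con 2 :+ d)) refl D ⟩
      D * D + 4 * suc (suc D)
    ≤⟨ +-monoˡ-≤ _ (square≤4·tent D) ⟩
      4 * tent D + 4 * suc (suc D)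
    ≡⟨ sym (*-distribˡ-+ 4 (tent D) (suc (suc D))) ⟩
      4 * (tent D + suc (suc D))
    ≤⟨ *-monoʳ-≤ 4 (≤-trans (≤-reflexive (+-comm (tent D) _)) (tent-step D)) ⟩
      4 * tent (suc (suc D)) ∎
    where open ≤-Reasoning

-- Lower bounds on a node sum from one witness per level.  Nodes are sorted
-- into levels by a key; below L k v keeps the value v iff its key k is < L,
-- and at L k v keeps it iff k = L.
module LevelSums where
  open import Data.Nat using (zero; suc; _+_; _≤_; _<_; z≤n)
  open import Data.Nat.Properties using (+-identityʳ; ≤-refl; ≤-trans; +-mono-≤; n<1+n; m<n⇒m<1+n)
  open import Data.Product using (∃; _×_; _,_)
  open import Relation.Binary.PropositionalEquality using (_≡_; refl; sym; trans; cong)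
  open NodeSums
  open RangeSums using (sumTo; sumTo-snoc)

  below : ℕ → ℕ → ℕ → ℕ
  below zero k v = 0
  below (suc L) zero v = v
  below (suc L) (suc k) v = below L k v

  at : ℕ → ℕ → ℕ → ℕ
  at zero zero v = v
  at zero (suc k) v = 0
  at (suc L) zero v = 0
  at (suc L) (suc k) v = at L k v

  below-suc : ∀ L k v → below (suc L) k v ≡ below L k v + at L k v
  below-suc zero zero v = refl
  below-suc zero (suc k) v = refl
  below-suc (suc L) zero v = sym (+-identityʳ v)
  below-suc (suc L) (suc k) v = below-suc L k v

  at-self : ∀ L v → at L L v ≡ v
  at-self zero v = refl
  at-self (suc L) v = at-self L v

  below≤ : ∀ L k v → below L k v ≤ v
  below≤ zero k v = z≤n
  below≤ (suc L) zero v = ≤-refl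
  below≤ (suc L) (suc k) v = below≤ L k v

  -- If every level j < L contains a node u with w(j) ≤ g(u), then
  -- Σ_{j<L} w(j) ≤ Σₓ g(x): distinct levels contribute distinct nodes.
  level-sum-bound : ∀ {n} (key g : Fin n → ℕ) (w : ℕ → ℕ) L →
                    (∀ j → j < L → ∃ λ u → key u ≡ j × w j ≤ g u) →
                    sumTo L w ≤ sumV g
  level-sum-bound key g w L witness =
    ≤-trans (bound-below L witness) (sumV-mono (λ x → below≤ L (key x) (g x)))
    where
    open Data.Nat.Properties.≤-Reasoning

    lowLevels levelAt : ℕ → ℕ
    lowLevels M = sumV (λ x → below M (key x) (g x))
    levelAt M = sumV (λ x → at M (key x) (g x))

    lowLevels-suc : ∀ M → lowLevels (suc M) ≡ lowLevels M + levelAt M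
    lowLevels-suc M = trans (sumV-cong (λ x → below-suc M (key x) (g x)))
                            (sumV-+ (λ x → below M (key x) (g x)) (λ x → at M (key x) (g x)))

    bound-below : ∀ M → (∀ j → j < M → ∃ λ u → key u ≡ j × w j ≤ g u) →
                  sumTo M w ≤ lowLevels M
    bound-below zero _ = z≤n
    bound-below (suc M) witnesses with witnesses M (n<1+n M)
    ... | u , keyu≡M , wM≤gu = begin
        sumTo (suc M) w
      ≡⟨ sumTo-snoc M w ⟩
        sumTo M w + w M
      ≤⟨ +-mono-≤ (bound-below M (λ j j<M → witnesses j (m<n⇒m<1+n j<M))) wM≤levelAt ⟩
        lowLevels M + levelAt M
      ≡⟨ sym (lowLevels-suc M) ⟩
        lowLevels (suc M) ∎
      where
      wM≤levelAt : w M ≤ levelAt M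
      wM≤levelAt = begin
        w M                  ≤⟨ wM≤gu ⟩
        g u                  ≡⟨ sym (at-self M (g u)) ⟩
        at M M (g u)         ≡⟨ cong (λ k → at M k (g u)) (sym keyu≡M) ⟩
        at M (key u) (g u)   ≤⟨ term≤sumV (λ x → at M (key x) (g x)) u ⟩
        levelAt M            ∎

module DistanceGap {n : ℕ} {H H' : Graph n} (sub : H ⊆E H') {s : Fin n}
                   {dH dH' : Fin n → ℕ}
                   (isH : ∀ x → IsDist H x s (dH x))
                   (isH' : ∀ x → IsDist H' x s (dH' x)) where
  open import Data.Nat using (_+_; _*_; _∸_; _≤_; _<_)
  open import Data.Nat.Properties
  open import Data.Product using (∃; _×_; _,_)
  open import Relation.Binary.PropositionalEquality using (_≡_; sym; trans; cong)
  open Walks {G = H'} using (reverse)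
  open EdgeInclusion {H = H} {H' = H'} sub using (liftWalk; distance-antitone)
  open Distances isH using (geodesicPoint)
  module DH' = Distances isH'
  open NodeSums using (sumV-cong; sumV-+)
  open RangeSums using (square≤4·tent)
  open LevelSums using (level-sum-bound)

  gap : Fin n → ℕ
  gap x = dH x ∸ dH' x

  dH'≤dH : ∀ x → dH' x ≤ dH x
  dH'≤dH x = distance-antitone (isH x) (isH' x)

  total-gap : sumV dH' + sumV gap ≡ sumV dH
  total-gap = trans (sym (sumV-+ dH' gap)) (sumV-cong (λ x → m+[n∸m]≡n (dH'≤dH x)))

  -- Arithmetic identity behind the gap bound: both sides equal A ∸ (B + 2j).
  ∸-regroup : ∀ A B j → (A ∸ B) ∸ (j + j) ≡ (A ∸ j) ∸ (j + B)
  ∸-regroup A B j = begin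
      (A ∸ B) ∸ (j + j)   ≡⟨ ∸-+-assoc A B (j + j) ⟩
      A ∸ (B + (j + j))   ≡⟨ cong (A ∸_) (+-comm B (j + j)) ⟩
      A ∸ ((j + j) + B)   ≡⟨ cong (A ∸_) (+-assoc j j B) ⟩
      A ∸ (j + (j + B))   ≡⟨ sym (∸-+-assoc A j (j + B)) ⟩
      (A ∸ j) ∸ (j + B)   ∎
    where open Relation.Binary.PropositionalEquality.≡-Reasoning

  level≤dH : ∀ y j → j < gap y → j ≤ dH y
  level≤dH y j j<gap = ≤-trans (<⇒≤ j<gap) (m∸n≤m (dH y) (dH' y))

  level-witness : ∀ y j → j < gap y →
                  ∃ λ u → dH y ∸ dH u ≡ j × gap y ∸ (j + j) ≤ gap u
  level-witness y j j<gap with geodesicPoint y j (level≤dH y j j<gap)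
  ... | u , y⇝u , dHu≡ = u , level , bound
    where
    level : dH y ∸ dH u ≡ j
    level = trans (cong (dH y ∸_) dHu≡) (m∸[m∸n]≡n (level≤dH y j j<gap))
    -- Walking back from u to y in H' and on to s bounds dH'(u).
    dH'u≤ : dH' u ≤ j + dH' y
    dH'u≤ = DH'.triangle (reverse (liftWalk y⇝u))
    bound : gap y ∸ (j + j) ≤ gap u
    bound = begin
        gap y ∸ (j + j)          ≡⟨ ∸-regroup (dH y) (dH' y) j ⟩
        (dH y ∸ j) ∸ (j + dH' y) ≤⟨ ∸-monoʳ-≤ (dH y ∸ j) dH'u≤ ⟩
        (dH y ∸ j) ∸ dH' u       ≡⟨ cong (_∸ dH' u) (sym dHu≡) ⟩
        gap u                    ∎
      where open ≤-Reasoning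

  gap-square : ∀ y → gap y * gap y ≤ 4 * sumV gap
  gap-square y = ≤-trans (square≤4·tent (gap y))
    (*-monoʳ-≤ 4 (level-sum-bound (λ u → dH y ∸ dH u) gap
                                  (λ j → gap y ∸ (j + j)) (gap y) (level-witness y)))

module RationalBound where
  import Data.Nat as ℕ
  open import Data.Integer using (+_)
  import Data.Integer as ℤ
  import Data.Integer.Properties as ℤ
  open import Data.Rational using (ℚ; 0ℚ; 1ℚ; mkℚ; _<_; _≤_; _+_; _*_; _/_; -_; toℚᵘ; *≤*; *<*; NonNegative; positive; nonNegative)
  open import Data.Rational.Properties
  import Data.Rational.Unnormalised as ℚᵘ
  import Data.Rational.Unnormalised.Properties as ℚᵘ
  open import Data.Nat.Coprimality using (1-coprimeTo)
  import Data.Nat.Coprimality as Coprimality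
  open import Relation.Binary.PropositionalEquality using (_≡_; sym; trans; cong; cong₂; subst; subst₂)

  toℚ : ℕ.ℕ → ℚ
  toℚ m = + m / 1

  toℚ-normal : ∀ m → toℚ m ≡ mkℚ (+ m) 0 (Coprimality.sym (1-coprimeTo m))
  toℚ-normal m = normalize-coprime (Coprimality.sym (1-coprimeTo m))

  -- toℚ is additive, multiplicative and monotone; each is checked on
  -- unnormalised representatives, where it is integer arithmetic.
  toℚ-+ : ∀ a b → toℚ (a ℕ.+ b) ≡ toℚ a + toℚ b
  toℚ-+ a b = toℚᵘ-injective (ℚᵘ.≃-trans unnormalised (ℚᵘ.≃-sym (toℚᵘ-homo-+ (toℚ a) (toℚ b))))
    where
    unnormalised : toℚᵘ (toℚ (a ℕ.+ b)) ℚᵘ.≃ (toℚᵘ (toℚ a) ℚᵘ.+ toℚᵘ (toℚ b))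
    unnormalised rewrite toℚ-normal (a ℕ.+ b) | toℚ-normal a | toℚ-normal b =
      ℚᵘ.*≡* (trans (ℤ.*-identityʳ _) (trans (ℤ.pos-+ a b)
        (sym (trans (ℤ.*-identityʳ _) (cong₂ ℤ._+_ (ℤ.*-identityʳ (+ a)) (ℤ.*-identityʳ (+ b)))))))

  toℚ-* : ∀ a b → toℚ (a ℕ.* b) ≡ toℚ a * toℚ b
  toℚ-* a b = toℚᵘ-injective (ℚᵘ.≃-trans unnormalised (ℚᵘ.≃-sym (toℚᵘ-homo-* (toℚ a) (toℚ b))))
    where
    unnormalised : toℚᵘ (toℚ (a ℕ.* b)) ℚᵘ.≃ (toℚᵘ (toℚ a) ℚᵘ.* toℚᵘ (toℚ b))
    unnormalised rewrite toℚ-normal (a ℕ.* b) | toℚ-normal a | toℚ-normal b =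
      ℚᵘ.*≡* (trans (ℤ.*-identityʳ _) (trans (ℤ.pos-* a b) (sym (ℤ.*-identityʳ _))))

  toℚ-mono : ∀ {a b} → a ℕ.≤ b → toℚ a ≤ toℚ b
  toℚ-mono {a} {b} a≤b rewrite toℚ-normal a | toℚ-normal b =
    *≤* (subst₂ ℤ._≤_ (sym (ℤ.*-identityʳ (+ a))) (sym (ℤ.*-identityʳ (+ b))) (ℤ.+≤+ a≤b))

  +-cancelˡ-≤ : ∀ p {x y} → p + x ≤ p + y → x ≤ y
  +-cancelˡ-≤ p {x} {y} p+x≤p+y = begin
      x              ≡⟨ sym (cancel x) ⟩
      - p + (p + x)  ≤⟨ +-monoʳ-≤ (- p) p+x≤p+y ⟩
      - p + (p + y)  ≡⟨ cancel y ⟩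
      y              ∎
    where
    open ≤-Reasoning
    cancel : ∀ z → - p + (p + z) ≡ z
    cancel z = trans (sym (+-assoc (- p) p z))
                     (trans (cong (_+ z) (+-inverseˡ p)) (+-identityˡ z))

  square-mono : ∀ {x y} → 0ℚ ≤ x → x ≤ y → x * x ≤ y * y
  square-mono {x} {y} 0≤x x≤y = begin
      x * x  ≤⟨ *-monoˡ-≤-nonNeg x {{nonNegative 0≤x}} x≤y ⟩
      x * y  ≤⟨ *-monoʳ-≤-nonNeg y {{nonNegative (≤-trans 0≤x x≤y)}} x≤y ⟩
      y * y  ∎
    where open ≤-Reasoning

  quarter : ℚ
  quarter = + 1 / 4

  0<quarter : 0ℚ < quarter
  0<quarter = *<* (ℤ.+<+ (ℕ.s≤s ℕ.z≤n))

  -- Since quarter * toℚ 4 computes to 1ℚ, a quarter of 4G is G.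
  quarter-of-4· : ∀ G → quarter * toℚ (4 ℕ.* G) ≡ toℚ G
  quarter-of-4· G = begin
      quarter * toℚ (4 ℕ.* G)     ≡⟨ cong (quarter *_) (toℚ-* 4 G) ⟩
      quarter * (toℚ 4 * toℚ G)   ≡⟨ sym (*-assoc quarter (toℚ 4) (toℚ G)) ⟩
      1ℚ * toℚ G                  ≡⟨ *-identityˡ (toℚ G) ⟩
      toℚ G                       ∎
    where open Relation.Binary.PropositionalEquality.≡-Reasoning

  rational-bound : ∀ {S S' G A B D} δ → 0ℚ < δ → D ℕ.* D ℕ.≤ 4 ℕ.* G →
                   S' ℕ.+ G ≡ S → B ℕ.+ D ≡ A → toℚ B + δ ≤ toℚ A →
                   toℚ S' + quarter * (δ * δ) ≤ toℚ S
  rational-bound {S} {S'} {G} {A} {B} {D} δ 0<δ D²≤4G S≡ A≡ B+δ≤A = begin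
      toℚ S' + quarter * (δ * δ)           ≤⟨ +-monoʳ-≤ (toℚ S') (*-monoˡ-≤-nonNeg quarter {{quarter≥0}} δ²≤) ⟩
      toℚ S' + quarter * toℚ (4 ℕ.* G)     ≡⟨ cong (λ t → toℚ S' + t) (quarter-of-4· G) ⟩
      toℚ S' + toℚ G                       ≡⟨ sym (toℚ-+ S' G) ⟩
      toℚ (S' ℕ.+ G)                       ≡⟨ cong toℚ S≡ ⟩
      toℚ S                                ∎
    where
    open ≤-Reasoning
    quarter≥0 : NonNegative quarter
    quarter≥0 = pos⇒nonNeg quarter {{positive 0<quarter}}
    δ≤D : δ ≤ toℚ D
    δ≤D = +-cancelˡ-≤ (toℚ B)
            (subst (λ a → toℚ B + δ ≤ a) (trans (cong toℚ (sym A≡)) (toℚ-+ B D)) B+δ≤A)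
    δ²≤ : δ * δ ≤ toℚ (4 ℕ.* G)
    δ²≤ = begin
      δ * δ            ≤⟨ square-mono (<⇒≤ 0<δ) δ≤D ⟩
      toℚ D * toℚ D    ≡⟨ sym (toℚ-* D D) ⟩
      toℚ (D ℕ.* D)    ≤⟨ toℚ-mono D²≤4G ⟩
      toℚ (4 ℕ.* G)    ∎

open import Data.Integer using (+_)
open import Data.Rational using (ℚ; 0ℚ; _<_; _≤_; _+_; _*_; _/_)
open import Data.Product using (∃; _×_; _,_)
open import Data.Nat.Properties using (m+[n∸m]≡n)
open RationalBound using (quarter; 0<quarter; rational-bound)

-- The theorem, with c = 1/4: combine gap(y)² ≤ 4·Σₓ gap(x) and
-- Σₓ dH = Σₓ dH' + Σₓ gap with the rational bound.  Connectivity of H is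
-- already implicit in the given distance function dH.
lemma3 : ∃ λ (c : ℚ) → 0ℚ < c ×
    (∀ (n : ℕ) (H H' : Graph n) → Connected H → H ⊆E H' →
    (s : Fin n) (δ : ℚ) → 0ℚ < δ →
    (dH dH' : Fin n → ℕ) →
    (∀ x → IsDist H x s (dH x)) → (∀ x → IsDist H' x s (dH' x)) →
    (∃ λ (y : Fin n) → (+ dH' y / 1) + δ ≤ (+ dH y / 1)) →
    (+ sumV dH' / 1) + c * (δ * δ) ≤ (+ sumV dH / 1))
lemma3 = quarter , 0<quarter ,
  λ n H H' _ sub s δ 0<δ dH dH' isH isH' (y , drop≥δ) →
    let open DistanceGap {H = H} {H' = H'} sub isH isH'
    in rational-bound {S' = sumV dH'} {G = sumV gap} {B = dH' y} {D = gap y}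
                      δ 0<δ (gap-square y) total-gap (m+[n∸m]≡n (dH'≤dH y)) drop≥δ
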